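{- Let $\{P_n(x)\}_{n\ge 1}$ be the sequence defined in the context. For every even $n\ge 2$, $P_n(1)=(2^n-1)\,(\frac n2)!/(n+1)$, and for every odd $n\ge1$, $P_n(1)=(2^n-1)\,(\frac{n-1}{2})!$.
   Context: The sequence $\{P_n(x)\}_{n\ge1}$ of rational functions of $x$ is defined by $P_1=P_2=1$ and, for $n\ge 2$: if $n$ is odd, $4(2x+n)P_{n+1}(x)=2(x+n)P_n(x)+(2x+n)P_n(x+1)+(4x+n)\ell_n(x)$; if $n$ is even, $4P_{n+1}(x)=4(x+n)P_n(x)+2(2x+n+1)P_n(x+1)+(4x+n)\ell_{n-1}(x)$. Here for odd $r\ge1$, $\ell_r(x)=\prod_{j=1}^{(r-1)/2}(x+j)$ (the empty product equals $1$). -}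

module Defs where

open import Data.Nat using (ℕ; zero; suc; _+_; _*_; ⌊_/2⌋)
open import Data.Bool using (Bool; true; false; if_then_else_)
open import Data.Integer using (+_)
open import Data.Rational using (ℚ; _/_) renaming (_+_ to _+ℚ_; _*_ to _*ℚ_)

⟦_⟧ : ℕ → ℚ
⟦ a ⟧ = (+ a) / 1

lprod : ℕ → ℕ → ℕ
lprod zero k = 1
lprod (suc t) k = lprod t k * (k + suc t)

-- ℓ_r(x) = ∏_{j=1}^{(r-1)/2} (x + j) for odd r, evaluated at x = k
-- (for odd r, (r-1)/2 = ⌊ r/2 ⌋)
ℓ : ℕ → ℕ → ℚ
ℓ r k = ⟦ lprod ⌊ r /2⌋ k ⟧

isEven : ℕ → Bool
isEven zero = true
isEven (suc zero) = false
isEven (suc (suc n)) = isEven n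

-- One recursion step: given n ≥ 2 (written n = 2 + m) and the values
-- p k = P_n(k) at natural k, compute P_{n+1}(k).
-- The denominators 4 and 4(2k+n) are positive for n ≥ 2, k ∈ ℕ.
next : (m : ℕ) → (ℕ → ℚ) → ℕ → ℚ
next m p k with isEven (suc (suc m))
... | false =
  (⟦ 2 * (k + n) ⟧ *ℚ p k +ℚ ⟦ 2 * k + n ⟧ *ℚ p (suc k) +ℚ ⟦ 4 * k + n ⟧ *ℚ ℓ n k)
    *ℚ ((+ 1) / 4) *ℚ ((+ 1) / suc (suc (2 * k + m)))   -- 1/(4(2k+n)), since 2k+n = 2 + (2k+m)
  where n = suc (suc m)
... | true =
  (⟦ 4 * (k + n) ⟧ *ℚ p k +ℚ ⟦ 2 * (2 * k + n + 1) ⟧ *ℚ p (suc k) +ℚ ⟦ 4 * k + n ⟧ *ℚ ℓ (suc m) k)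
    *ℚ ((+ 1) / 4)
  where n = suc (suc m)

-- P n k = P_n(k), the rational function P_n evaluated at the natural number x = k.
-- P 0 is junk (the sequence is indexed from n = 1).
P : ℕ → ℕ → ℚ
P zero k = ⟦ 1 ⟧
P (suc zero) k = ⟦ 1 ⟧
P (suc (suc zero)) k = ⟦ 1 ⟧
P (suc (suc (suc m))) k = next m (P (suc (suc m))) k

{-# OPTIONS --safe #-}
-- Write the index as n = 2j+2 or n = 2j+3. By induction on j, the values P_n(k) at natural k are
-- natural numbers obeying a first-order recurrence in k,
--   (2k+2j+3) P_{2j+2}(k+1) + (j+1) ℓ_{2j+1}(k) = (2k+4j+4) P_{2j+2}(k),
--   (2k+2j+3) P_{2j+3}(k+1) + (2j+3) ℓ_{2j+3}(k) = (2k+4j+6) P_{2j+3}(k),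
-- and P_{2j+2}(0) = P_{2j+1}(0) = 4^j j!. Substituting these recurrences into the defining recursion cancels
-- its denominators:
--   P_{2j+3}(k) = (2k+2j+3) P_{2j+2}(k+1) + ℓ_{2j+3}(k),   2 P_{2j+4}(k) = P_{2j+3}(k+1) + ℓ_{2j+3}(k),
-- and through these formulas each recurrence implies the next one (the odd recurrence also shows that
-- P_{2j+3}(k+1) + ℓ_{2j+3}(k) is even). At k = 0 the recurrences express P_n(1) through P_n(0).
-- All the algebra is done on the natural numbers, so only the unfolding of P involves ℚ.
module Submission where

open import Defs
open import Data.Nat using (ℕ; zero; suc; _+_; _*_; _∸_; _^_; _!; ⌊_/2⌋; NonZero)
open import Data.Nat.Properties
  using (*-suc; *-comm; *-assoc; +-comm; +-suc; +-cancelʳ-≡; *-cancelˡ-≡; ^-*-assoc; m^n≢0; *-commutativeSemigroup)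
open import Data.Nat.Divisibility using (_∣_; quotient; m∣m*n; ∣m⇒∣m*n; ∣m+n∣m⇒∣n; m∣n⇒n≡m*quotient)
open import Data.Nat.Tactic.RingSolver using (solve-∀; solve)
open import Algebra.Properties.CommutativeSemigroup *-commutativeSemigroup using (xy∙z≈xz∙y)
open import Data.Integer using (+_)
import Data.Integer as ℤ
import Data.Integer.Properties as ℤ
import Data.Integer.Tactic.RingSolver as ℤ-Solver
open import Data.Rational using (ℚ; _/_; 1ℚ; toℚᵘ) renaming (_+_ to _+ℚ_; _*_ to _*ℚ_)
import Data.Rational.Properties as ℚ
open import Data.Rational.Unnormalised using (mkℚᵘ; *≡*) renaming (_+_ to _+ᵘ_; _*_ to _*ᵘ_)
import Data.Rational.Unnormalised.Properties as ℚᵘ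
open import Data.Bool using (true; false)
open import Data.List using (_∷_; [])
open import Data.Product using (_×_; _,_)
open import Function using (_∘_)
open import Relation.Binary.PropositionalEquality

isEven-double : ∀ j → isEven (2 * j) ≡ true
isEven-double zero = refl
isEven-double (suc j) = trans (cong isEven (*-suc 2 j)) (isEven-double j)

isEven-suc-double : ∀ j → isEven (suc (2 * j)) ≡ false
isEven-suc-double zero = refl
isEven-suc-double (suc j) = trans (cong (isEven ∘ suc) (*-suc 2 j)) (isEven-suc-double j)

⌊suc-double/2⌋ : ∀ j → ⌊ suc (2 * j) /2⌋ ≡ j
⌊suc-double/2⌋ zero = refl
⌊suc-double/2⌋ (suc j) = trans (cong (⌊_/2⌋ ∘ suc) (*-suc 2 j)) (cong suc (⌊suc-double/2⌋ j))

2∣[1+2m]*n⇒2∣n : ∀ m n → 2 ∣ suc (2 * m) * n → 2 ∣ n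
2∣[1+2m]*n⇒2∣n m n 2∣[1+2m]*n =
  ∣m+n∣m⇒∣n (subst (2 ∣_) (+-comm n (2 * m * n)) 2∣[1+2m]*n) (∣m⇒∣m*n n (m∣m*n m))

[m∸1]*n+n≡m*n : ∀ m n .{{_ : NonZero m}} → (m ∸ 1) * n + n ≡ m * n
[m∸1]*n+n≡m*n (suc m) n = +-comm (m * n) n

4^n≡2^[2*n] : ∀ n → 4 ^ n ≡ 2 ^ (2 * n)
4^n≡2^[2*n] = ^-*-assoc 2 2

lprod-zero : ∀ j → lprod j 0 ≡ j !
lprod-zero zero = refl
lprod-zero (suc j) = trans (cong (_* suc j) (lprod-zero j)) (*-comm (j !) (suc j))

lprod-shift : ∀ j k → lprod j (suc k) * suc k ≡ lprod (suc j) k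
lprod-shift zero k = cong (1 *_) (+-comm 1 k)
lprod-shift (suc j) k = begin
  lprod j (suc k) * (suc k + suc j) * suc k    ≡⟨ xy∙z≈xz∙y (lprod j (suc k)) (suc k + suc j) (suc k) ⟩
  lprod j (suc k) * suc k * (suc k + suc j)    ≡⟨ cong₂ _*_ (lprod-shift j k) (sym (+-suc k (suc j))) ⟩
  lprod (suc j) k * (k + suc (suc j))          ∎
  where open ≡-Reasoning

⟦⟧-suc : ∀ a → ⟦ suc a ⟧ ≡ 1ℚ +ℚ ⟦ a ⟧
⟦⟧-suc a = ℚ.toℚᵘ-injective (begin
  toℚᵘ ⟦ suc a ⟧                   ≈⟨ ℚ.toℚᵘ-fromℚᵘ (mkℚᵘ (+ suc a) 0) ⟩
  mkℚᵘ (+ suc a) 0                 ≈⟨ *≡* (identity (+ a)) ⟩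
  mkℚᵘ (+ 1) 0 +ᵘ mkℚᵘ (+ a) 0      ≈⟨ ℚᵘ.+-congʳ (mkℚᵘ (+ 1) 0) (ℚᵘ.≃-sym (ℚ.toℚᵘ-fromℚᵘ (mkℚᵘ (+ a) 0))) ⟩
  toℚᵘ 1ℚ +ᵘ toℚᵘ ⟦ a ⟧             ≈⟨ ℚᵘ.≃-sym (ℚ.toℚᵘ-homo-+ 1ℚ ⟦ a ⟧) ⟩
  toℚᵘ (1ℚ +ℚ ⟦ a ⟧)                ∎)
  where
  open ℚᵘ.≃-Reasoning
  identity : ∀ x → (+ 1 ℤ.+ x) ℤ.* + 1 ≡ (+ 1 ℤ.* + 1 ℤ.+ x ℤ.* + 1) ℤ.* + 1
  identity = ℤ-Solver.solve-∀

⟦⟧-+ : ∀ a b → ⟦ a + b ⟧ ≡ ⟦ a ⟧ +ℚ ⟦ b ⟧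
⟦⟧-+ zero b = sym (ℚ.+-identityˡ ⟦ b ⟧)
⟦⟧-+ (suc a) b = begin
  ⟦ suc (a + b) ⟧          ≡⟨ ⟦⟧-suc (a + b) ⟩
  1ℚ +ℚ ⟦ a + b ⟧          ≡⟨ cong (1ℚ +ℚ_) (⟦⟧-+ a b) ⟩
  1ℚ +ℚ (⟦ a ⟧ +ℚ ⟦ b ⟧)   ≡⟨ ℚ.+-assoc 1ℚ ⟦ a ⟧ ⟦ b ⟧ ⟨
  (1ℚ +ℚ ⟦ a ⟧) +ℚ ⟦ b ⟧   ≡⟨ cong (_+ℚ ⟦ b ⟧) (⟦⟧-suc a) ⟨
  ⟦ suc a ⟧ +ℚ ⟦ b ⟧       ∎
  where open ≡-Reasoning

⟦⟧-* : ∀ a b → ⟦ a * b ⟧ ≡ ⟦ a ⟧ *ℚ ⟦ b ⟧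
⟦⟧-* zero b = sym (ℚ.*-zeroˡ ⟦ b ⟧)
⟦⟧-* (suc a) b = begin
  ⟦ b + a * b ⟧                  ≡⟨ ⟦⟧-+ b (a * b) ⟩
  ⟦ b ⟧ +ℚ ⟦ a * b ⟧             ≡⟨ cong (⟦ b ⟧ +ℚ_) (⟦⟧-* a b) ⟩
  ⟦ b ⟧ +ℚ ⟦ a ⟧ *ℚ ⟦ b ⟧        ≡⟨ cong (_+ℚ ⟦ a ⟧ *ℚ ⟦ b ⟧) (ℚ.*-identityˡ ⟦ b ⟧) ⟨
  1ℚ *ℚ ⟦ b ⟧ +ℚ ⟦ a ⟧ *ℚ ⟦ b ⟧  ≡⟨ ℚ.*-distribʳ-+ ⟦ b ⟧ 1ℚ ⟦ a ⟧ ⟨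
  (1ℚ +ℚ ⟦ a ⟧) *ℚ ⟦ b ⟧         ≡⟨ cong (_*ℚ ⟦ b ⟧) (⟦⟧-suc a) ⟨
  ⟦ suc a ⟧ *ℚ ⟦ b ⟧             ∎
  where open ≡-Reasoning

⟦⟧-combination : ∀ a b c x y z {X Y Z : ℚ} → X ≡ ⟦ x ⟧ → Y ≡ ⟦ y ⟧ → Z ≡ ⟦ z ⟧ →
  ⟦ a ⟧ *ℚ X +ℚ ⟦ b ⟧ *ℚ Y +ℚ ⟦ c ⟧ *ℚ Z ≡ ⟦ a * x + b * y + c * z ⟧
⟦⟧-combination a b c x y z refl refl refl = sym (begin
  ⟦ a * x + b * y + c * z ⟧                  ≡⟨ ⟦⟧-+ (a * x + b * y) (c * z) ⟩
  ⟦ a * x + b * y ⟧ +ℚ ⟦ c * z ⟧             ≡⟨ cong₂ _+ℚ_ (⟦⟧-+ (a * x) (b * y)) (⟦⟧-* c z) ⟩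
  ⟦ a * x ⟧ +ℚ ⟦ b * y ⟧ +ℚ ⟦ c ⟧ *ℚ ⟦ z ⟧   ≡⟨ cong₂ (λ u v → u +ℚ v +ℚ ⟦ c ⟧ *ℚ ⟦ z ⟧) (⟦⟧-* a x) (⟦⟧-* b y) ⟩
  ⟦ a ⟧ *ℚ ⟦ x ⟧ +ℚ ⟦ b ⟧ *ℚ ⟦ y ⟧ +ℚ ⟦ c ⟧ *ℚ ⟦ z ⟧ ∎)
  where open ≡-Reasoning

⟦n*x⟧*[1/n]≡⟦x⟧ : ∀ n x .{{_ : NonZero n}} → ⟦ n * x ⟧ *ℚ ((+ 1) / n) ≡ ⟦ x ⟧
⟦n*x⟧*[1/n]≡⟦x⟧ n@(suc d) x = ℚ.toℚᵘ-injective (begin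
  toℚᵘ (⟦ n * x ⟧ *ℚ ((+ 1) / n))          ≈⟨ ℚ.toℚᵘ-homo-* ⟦ n * x ⟧ ((+ 1) / n) ⟩
  toℚᵘ ⟦ n * x ⟧ *ᵘ toℚᵘ ((+ 1) / n)       ≈⟨ ℚᵘ.*-cong (ℚ.toℚᵘ-fromℚᵘ (mkℚᵘ (+ (n * x)) 0)) (ℚ.toℚᵘ-fromℚᵘ (mkℚᵘ (+ 1) d)) ⟩
  mkℚᵘ (+ (n * x)) 0 *ᵘ mkℚᵘ (+ 1) d       ≈⟨ *≡* (trans (cong (λ t → t ℤ.* + 1 ℤ.* + 1) (ℤ.pos-* n x)) (identity (+ n) (+ x))) ⟩
  mkℚᵘ (+ x) 0                             ≈⟨ ℚ.toℚᵘ-fromℚᵘ (mkℚᵘ (+ x) 0) ⟨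
  toℚᵘ ⟦ x ⟧                               ∎)
  where
  open ℚᵘ.≃-Reasoning
  identity : ∀ N X → N ℤ.* X ℤ.* + 1 ℤ.* + 1 ≡ X ℤ.* (+ 1 ℤ.* N)
  identity = ℤ-Solver.solve-∀

[n*x]/n≡⟦x⟧ : ∀ n x .{{_ : NonZero n}} → (+ (n * x)) / n ≡ ⟦ x ⟧
[n*x]/n≡⟦x⟧ n@(suc d) x = ℚ.toℚᵘ-injective (begin
  toℚᵘ ((+ (n * x)) / n)   ≈⟨ ℚ.toℚᵘ-fromℚᵘ (mkℚᵘ (+ (n * x)) d) ⟩
  mkℚᵘ (+ (n * x)) d       ≈⟨ *≡* (trans (cong (ℤ._* + 1) (ℤ.pos-* n x)) (identity (+ n) (+ x))) ⟩
  mkℚᵘ (+ x) 0             ≈⟨ ℚ.toℚᵘ-fromℚᵘ (mkℚᵘ (+ x) 0) ⟨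
  toℚᵘ ⟦ x ⟧               ∎)
  where
  open ℚᵘ.≃-Reasoning
  identity : ∀ N X → N ℤ.* X ℤ.* + 1 ≡ X ℤ.* N
  identity = ℤ-Solver.solve-∀

next-even : ∀ m p k → isEven m ≡ true →
  next m p k ≡ (⟦ 4 * (k + suc (suc m)) ⟧ *ℚ p k +ℚ ⟦ 2 * (2 * k + suc (suc m) + 1) ⟧ *ℚ p (suc k)
                 +ℚ ⟦ 4 * k + suc (suc m) ⟧ *ℚ ℓ (suc m) k) *ℚ ((+ 1) / 4)
next-even m p k even rewrite even = refl

next-odd : ∀ m p k → isEven m ≡ false →
  next m p k ≡ (⟦ 2 * (k + suc (suc m)) ⟧ *ℚ p k +ℚ ⟦ 2 * k + suc (suc m) ⟧ *ℚ p (suc k)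
                 +ℚ ⟦ 4 * k + suc (suc m) ⟧ *ℚ ℓ (suc (suc m)) k) *ℚ ((+ 1) / 4) *ℚ ((+ 1) / suc (suc (2 * k + m)))
next-odd m p k odd rewrite odd = refl

ℓ-odd : ∀ j k → ℓ (1 + 2 * j) k ≡ ⟦ lprod j k ⟧
ℓ-odd j k = cong (λ t → ⟦ lprod t k ⟧) (⌊suc-double/2⌋ j)

ℓ-odd-suc : ∀ j k → ℓ (3 + 2 * j) k ≡ ⟦ lprod (suc j) k ⟧
ℓ-odd-suc j k = cong (λ t → ⟦ lprod (suc t) k ⟧) (⌊suc-double/2⌋ j)

EvenRecurrence : ℕ → (ℕ → ℕ) → Set
EvenRecurrence j e = ∀ k → (2 * k + 2 * j + 3) * e (suc k) + (j + 1) * lprod j k ≡ (2 * k + 4 * j + 4) * e k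

OddRecurrence : ℕ → (ℕ → ℕ) → Set
OddRecurrence j o = ∀ k → (2 * k + 2 * j + 3) * o (suc k) + (2 * j + 3) * lprod (suc j) k ≡ (2 * k + 4 * j + 6) * o k

odd-next : ℕ → (ℕ → ℕ) → ℕ → ℕ
odd-next j e k = (2 * k + 2 * j + 3) * e (suc k) + lprod (suc j) k

even-numerator : ∀ j {e : ℕ → ℕ} → EvenRecurrence j e → ∀ k →
  4 * (k + (2 + 2 * j)) * e k + 2 * (2 * k + (2 + 2 * j) + 1) * e (suc k) + (4 * k + (2 + 2 * j)) * lprod j k
    ≡ 4 * odd-next j e k
even-numerator j {e} rec k = numerator k j (e k) (e (suc k)) (lprod j k) (rec k)
  where
  numerator : ∀ (k j X Y L : ℕ) → (2 * k + 2 * j + 3) * Y + (j + 1) * L ≡ (2 * k + 4 * j + 4) * X →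
    4 * (k + (2 + 2 * j)) * X + 2 * (2 * k + (2 + 2 * j) + 1) * Y + (4 * k + (2 + 2 * j)) * L
      ≡ 4 * ((2 * k + 2 * j + 3) * Y + L * (k + suc j))
  numerator k j X Y L rel = begin
    4 * (k + (2 + 2 * j)) * X + 2 * (2 * k + (2 + 2 * j) + 1) * Y + (4 * k + (2 + 2 * j)) * L
      ≡⟨ solve (k ∷ j ∷ X ∷ Y ∷ L ∷ []) ⟩
    2 * ((2 * k + 4 * j + 4) * X) + (4 * k + 4 * j + 6) * Y + (4 * k + 2 * j + 2) * L
      ≡⟨ cong (λ t → 2 * t + (4 * k + 4 * j + 6) * Y + (4 * k + 2 * j + 2) * L) rel ⟨
    2 * ((2 * k + 2 * j + 3) * Y + (j + 1) * L) + (4 * k + 4 * j + 6) * Y + (4 * k + 2 * j + 2) * L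
      ≡⟨ solve (k ∷ j ∷ Y ∷ L ∷ []) ⟩
    4 * ((2 * k + 2 * j + 3) * Y + L * (k + suc j))
      ∎
    where open ≡-Reasoning

evenRec⇒oddRec : ∀ j {e : ℕ → ℕ} → EvenRecurrence j e → OddRecurrence j (odd-next j e)
evenRec⇒oddRec j {e} rec k =
  transfer k j (e (suc k)) (e (suc (suc k))) (lprod j k) (lprod j (suc k)) (rec (suc k)) (lprod-shift j k)
  where
  transfer : ∀ (k j Y Z L L′ : ℕ) →
    (2 * suc k + 2 * j + 3) * Z + (j + 1) * L′ ≡ (2 * suc k + 4 * j + 4) * Y → L′ * suc k ≡ L * (k + suc j) →
    (2 * k + 2 * j + 3) * ((2 * suc k + 2 * j + 3) * Z + L′ * (suc k + suc j)) + (2 * j + 3) * (L * (k + suc j))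
      ≡ (2 * k + 4 * j + 6) * ((2 * k + 2 * j + 3) * Y + L * (k + suc j))
  transfer k j Y Z L L′ rel shift = begin
    (2 * k + 2 * j + 3) * ((2 * suc k + 2 * j + 3) * Z + L′ * (suc k + suc j)) + (2 * j + 3) * (L * (k + suc j))
      ≡⟨ solve (k ∷ j ∷ Z ∷ L ∷ L′ ∷ []) ⟩
    (2 * k + 2 * j + 3) * ((2 * suc k + 2 * j + 3) * Z + (j + 1) * L′) + (2 * k + 2 * j + 3) * (L′ * suc k)
      + (2 * j + 3) * (L * (k + suc j))
      ≡⟨ cong₂ (λ u v → (2 * k + 2 * j + 3) * u + (2 * k + 2 * j + 3) * v + (2 * j + 3) * (L * (k + suc j))) rel shift ⟩
    (2 * k + 2 * j + 3) * ((2 * suc k + 4 * j + 4) * Y) + (2 * k + 2 * j + 3) * (L * (k + suc j))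
      + (2 * j + 3) * (L * (k + suc j))
      ≡⟨ solve (k ∷ j ∷ Y ∷ L ∷ []) ⟩
    (2 * k + 4 * j + 6) * ((2 * k + 2 * j + 3) * Y + L * (k + suc j))
      ∎
    where open ≡-Reasoning

even-at-zero : ∀ j {e : ℕ → ℕ} → EvenRecurrence j e → e 0 ≡ 4 ^ j * j ! → (2 * j + 3) * e 1 + suc j ! ≡ 4 ^ suc j * suc j !
even-at-zero j {e} rec e₀ = begin
  (2 * j + 3) * e 1 + suc j * j !                   ≡⟨ cong (λ l → (2 * j + 3) * e 1 + suc j * l) (lprod-zero j) ⟨
  (2 * j + 3) * e 1 + suc j * lprod j 0             ≡⟨ at-zero j (e 0) (e 1) (lprod j 0) (rec 0) ⟩
  4 * suc j * e 0                                   ≡⟨ cong (4 * suc j *_) e₀ ⟩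
  4 * suc j * (4 ^ j * j !)                         ≡⟨ rearrange (4 ^ j) (j !) j ⟩
  4 ^ suc j * suc j !                               ∎
  where
  open ≡-Reasoning
  at-zero : ∀ (j X Y L : ℕ) → (2 * j + 3) * Y + (j + 1) * L ≡ (4 * j + 4) * X → (2 * j + 3) * Y + suc j * L ≡ 4 * suc j * X
  at-zero j X Y L rel = begin
    (2 * j + 3) * Y + suc j * L     ≡⟨ solve (j ∷ Y ∷ L ∷ []) ⟩
    (2 * j + 3) * Y + (j + 1) * L   ≡⟨ rel ⟩
    (4 * j + 4) * X                 ≡⟨ solve (j ∷ X ∷ []) ⟩
    4 * suc j * X                   ∎
  rearrange : ∀ p f j → 4 * suc j * (p * f) ≡ 4 * p * (suc j * f)
  rearrange = solve-∀

oddRec⇒evenness : ∀ j {o : ℕ → ℕ} → OddRecurrence j o → ∀ k → 2 ∣ o (suc k) + lprod (suc j) k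
oddRec⇒evenness j {o} rec k = 2∣[1+2m]*n⇒2∣n (k + j + 1) (o (suc k) + lprod (suc j) k)
  (subst (2 ∣_) (sym (doubled k j (o k) (o (suc k)) (lprod (suc j) k) (rec k))) (m∣m*n ((k + 2 * j + 3) * o k + k * lprod (suc j) k)))
  where
  doubled : ∀ (k j X Y L : ℕ) → (2 * k + 2 * j + 3) * Y + (2 * j + 3) * L ≡ (2 * k + 4 * j + 6) * X →
    suc (2 * (k + j + 1)) * (Y + L) ≡ 2 * ((k + 2 * j + 3) * X + k * L)
  doubled k j X Y L rel = begin
    suc (2 * (k + j + 1)) * (Y + L)                        ≡⟨ solve (k ∷ j ∷ Y ∷ L ∷ []) ⟩
    (2 * k + 2 * j + 3) * Y + (2 * j + 3) * L + 2 * k * L   ≡⟨ cong (_+ 2 * k * L) rel ⟩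
    (2 * k + 4 * j + 6) * X + 2 * k * L                     ≡⟨ solve (k ∷ j ∷ X ∷ L ∷ []) ⟩
    2 * ((k + 2 * j + 3) * X + k * L)                       ∎
    where open ≡-Reasoning

odd-numerator : ∀ j {o e : ℕ → ℕ} → OddRecurrence j o → (∀ k → 2 * e k ≡ o (suc k) + lprod (suc j) k) → ∀ k →
  2 * (k + (3 + 2 * j)) * o k + (2 * k + (3 + 2 * j)) * o (suc k) + (4 * k + (3 + 2 * j)) * lprod (suc j) k
    ≡ 4 * (suc (suc (2 * k + suc (2 * j))) * e k)
odd-numerator j {o} {e} rec halve k = numerator k j (o k) (o (suc k)) (lprod (suc j) k) (e k) (rec k) (halve k)
  where
  numerator : ∀ (k j X Y L W : ℕ) → (2 * k + 2 * j + 3) * Y + (2 * j + 3) * L ≡ (2 * k + 4 * j + 6) * X → 2 * W ≡ Y + L →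
    2 * (k + (3 + 2 * j)) * X + (2 * k + (3 + 2 * j)) * Y + (4 * k + (3 + 2 * j)) * L
      ≡ 4 * (suc (suc (2 * k + suc (2 * j))) * W)
  numerator k j X Y L W rel 2W≡Y+L = begin
    2 * (k + (3 + 2 * j)) * X + (2 * k + (3 + 2 * j)) * Y + (4 * k + (3 + 2 * j)) * L
      ≡⟨ solve (k ∷ j ∷ X ∷ Y ∷ L ∷ []) ⟩
    (2 * k + 4 * j + 6) * X + (2 * k + 2 * j + 3) * Y + (4 * k + 2 * j + 3) * L
      ≡⟨ cong (λ t → t + (2 * k + 2 * j + 3) * Y + (4 * k + 2 * j + 3) * L) rel ⟨
    (2 * k + 2 * j + 3) * Y + (2 * j + 3) * L + (2 * k + 2 * j + 3) * Y + (4 * k + 2 * j + 3) * L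
      ≡⟨ solve (k ∷ j ∷ Y ∷ L ∷ []) ⟩
    2 * (2 * k + 2 * j + 3) * (Y + L)
      ≡⟨ cong (2 * (2 * k + 2 * j + 3) *_) 2W≡Y+L ⟨
    2 * (2 * k + 2 * j + 3) * (2 * W)
      ≡⟨ solve (k ∷ j ∷ W ∷ []) ⟩
    4 * (suc (suc (2 * k + suc (2 * j))) * W)
      ∎
    where open ≡-Reasoning

oddRec⇒evenRec : ∀ j {o e : ℕ → ℕ} → OddRecurrence j o → (∀ k → 2 * e k ≡ o (suc k) + lprod (suc j) k) →
  EvenRecurrence (suc j) e
oddRec⇒evenRec j {o} {e} rec halve k = *-cancelˡ-≡ _ _ 2
  (transfer k j (o (suc k)) (o (suc (suc k))) (lprod (suc j) k) (lprod (suc j) (suc k)) (e k) (e (suc k))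
    (rec (suc k)) (lprod-shift (suc j) k) (halve k) (halve (suc k)))
  where
  transfer : ∀ (k j Y Z L L′ W W′ : ℕ) →
    (2 * suc k + 2 * j + 3) * Z + (2 * j + 3) * L′ ≡ (2 * suc k + 4 * j + 6) * Y →
    L′ * suc k ≡ L * (k + suc (suc j)) → 2 * W ≡ Y + L → 2 * W′ ≡ Z + L′ →
    2 * ((2 * k + 2 * suc j + 3) * W′ + (suc j + 1) * L) ≡ 2 * ((2 * k + 4 * suc j + 4) * W)
  transfer k j Y Z L L′ W W′ rel shift 2W≡Y+L 2W′≡Z+L′ = begin
    2 * ((2 * k + 2 * suc j + 3) * W′ + (suc j + 1) * L)
      ≡⟨ solve (k ∷ j ∷ W′ ∷ L ∷ []) ⟩
    (2 * k + 2 * j + 5) * (2 * W′) + 2 * (j + 2) * L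
      ≡⟨ cong (λ t → (2 * k + 2 * j + 5) * t + 2 * (j + 2) * L) 2W′≡Z+L′ ⟩
    (2 * k + 2 * j + 5) * (Z + L′) + 2 * (j + 2) * L
      ≡⟨ solve (k ∷ j ∷ Z ∷ L ∷ L′ ∷ []) ⟩
    (2 * suc k + 2 * j + 3) * Z + (2 * j + 3) * L′ + 2 * (L′ * suc k) + 2 * (j + 2) * L
      ≡⟨ cong₂ (λ u v → u + 2 * v + 2 * (j + 2) * L) rel shift ⟩
    (2 * suc k + 4 * j + 6) * Y + 2 * (L * (k + suc (suc j))) + 2 * (j + 2) * L
      ≡⟨ solve (k ∷ j ∷ Y ∷ L ∷ []) ⟩
    (2 * k + 4 * j + 8) * (Y + L)
      ≡⟨ cong ((2 * k + 4 * j + 8) *_) 2W≡Y+L ⟨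
    (2 * k + 4 * j + 8) * (2 * W)
      ≡⟨ solve (k ∷ j ∷ W ∷ []) ⟩
    2 * ((2 * k + 4 * suc j + 4) * W)
      ∎
    where open ≡-Reasoning

odd-at-one : ∀ j {o : ℕ → ℕ} → OddRecurrence j o → o 1 + suc j ! ≡ 2 * o 0
odd-at-one j {o} rec = *-cancelˡ-≡ _ _ (3 + 2 * j) (begin
  (3 + 2 * j) * (o 1 + suc j !)                          ≡⟨ cong (λ l → (3 + 2 * j) * (o 1 + l)) (lprod-zero (suc j)) ⟨
  (3 + 2 * j) * (o 1 + lprod (suc j) 0)                  ≡⟨ at-one j (o 0) (o 1) (lprod (suc j) 0) (rec 0) ⟩
  (3 + 2 * j) * (2 * o 0)                                ∎)
  where
  open ≡-Reasoning
  at-one : ∀ (j X Y L : ℕ) → (2 * j + 3) * Y + (2 * j + 3) * L ≡ (4 * j + 6) * X → (3 + 2 * j) * (Y + L) ≡ (3 + 2 * j) * (2 * X)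
  at-one j X Y L rel = begin
    (3 + 2 * j) * (Y + L)                 ≡⟨ solve (j ∷ Y ∷ L ∷ []) ⟩
    (2 * j + 3) * Y + (2 * j + 3) * L     ≡⟨ rel ⟩
    (4 * j + 6) * X                       ≡⟨ solve (j ∷ X ∷ []) ⟩
    (3 + 2 * j) * (2 * X)                 ∎

P-odd-values : ∀ j {e : ℕ → ℕ} → (∀ k → P (2 + 2 * j) k ≡ ⟦ e k ⟧) → EvenRecurrence j e →
  ∀ k → P (3 + 2 * j) k ≡ ⟦ odd-next j e k ⟧
P-odd-values j {e} P≡e rec k = begin
  P (3 + 2 * j) k
    ≡⟨ next-even (2 * j) (P (2 + 2 * j)) k (isEven-double j) ⟩
  (⟦ c₁ ⟧ *ℚ P (2 + 2 * j) k +ℚ ⟦ c₂ ⟧ *ℚ P (2 + 2 * j) (suc k) +ℚ ⟦ c₃ ⟧ *ℚ ℓ (1 + 2 * j) k) *ℚ ¼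
    ≡⟨ cong (_*ℚ ¼) (⟦⟧-combination c₁ c₂ c₃ (e k) (e (suc k)) (lprod j k) (P≡e k) (P≡e (suc k)) (ℓ-odd j k)) ⟩
  ⟦ c₁ * e k + c₂ * e (suc k) + c₃ * lprod j k ⟧ *ℚ ¼
    ≡⟨ cong (λ t → ⟦ t ⟧ *ℚ ¼) (even-numerator j rec k) ⟩
  ⟦ 4 * odd-next j e k ⟧ *ℚ ¼
    ≡⟨ ⟦n*x⟧*[1/n]≡⟦x⟧ 4 (odd-next j e k) ⟩
  ⟦ odd-next j e k ⟧
    ∎
  where
  open ≡-Reasoning
  ¼ = (+ 1) / 4
  c₁ = 4 * (k + (2 + 2 * j))
  c₂ = 2 * (2 * k + (2 + 2 * j) + 1)
  c₃ = 4 * k + (2 + 2 * j)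

P-even-values : ∀ j {o e : ℕ → ℕ} → (∀ k → P (3 + 2 * j) k ≡ ⟦ o k ⟧) → OddRecurrence j o →
  (∀ k → 2 * e k ≡ o (suc k) + lprod (suc j) k) → ∀ k → P (4 + 2 * j) k ≡ ⟦ e k ⟧
P-even-values j {o} {e} P≡o rec halve k = begin
  P (4 + 2 * j) k
    ≡⟨ next-odd (1 + 2 * j) (P (3 + 2 * j)) k (isEven-suc-double j) ⟩
  (⟦ c₁ ⟧ *ℚ P (3 + 2 * j) k +ℚ ⟦ c₂ ⟧ *ℚ P (3 + 2 * j) (suc k) +ℚ ⟦ c₃ ⟧ *ℚ ℓ (3 + 2 * j) k) *ℚ ¼ *ℚ 1/D
    ≡⟨ cong (λ t → t *ℚ ¼ *ℚ 1/D)
            (⟦⟧-combination c₁ c₂ c₃ (o k) (o (suc k)) (lprod (suc j) k) (P≡o k) (P≡o (suc k)) (ℓ-odd-suc j k)) ⟩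
  ⟦ c₁ * o k + c₂ * o (suc k) + c₃ * lprod (suc j) k ⟧ *ℚ ¼ *ℚ 1/D
    ≡⟨ cong (λ t → ⟦ t ⟧ *ℚ ¼ *ℚ 1/D) (odd-numerator j {e = e} rec halve k) ⟩
  ⟦ 4 * (D * e k) ⟧ *ℚ ¼ *ℚ 1/D
    ≡⟨ cong (_*ℚ 1/D) (⟦n*x⟧*[1/n]≡⟦x⟧ 4 (D * e k)) ⟩
  ⟦ D * e k ⟧ *ℚ 1/D
    ≡⟨ ⟦n*x⟧*[1/n]≡⟦x⟧ D (e k) ⟩
  ⟦ e k ⟧
    ∎
  where
  open ≡-Reasoning
  ¼ = (+ 1) / 4
  D = suc (suc (2 * k + suc (2 * j)))
  1/D = (+ 1) / D
  c₁ = 2 * (k + (3 + 2 * j))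
  c₂ = 2 * k + (3 + 2 * j)
  c₃ = 4 * k + (3 + 2 * j)

record EvenStage (j n : ℕ) : Set where
  field
    value      : ℕ → ℕ
    P≡value    : ∀ k → P n k ≡ ⟦ value k ⟧
    recurrence : EvenRecurrence j value
    value-zero : value 0 ≡ 4 ^ j * j !

record OddStage (j n : ℕ) : Set where
  field
    value      : ℕ → ℕ
    P≡value    : ∀ k → P n k ≡ ⟦ value k ⟧
    recurrence : OddRecurrence j value
    value-zero : value 0 ≡ 4 ^ suc j * suc j !

even⇒odd : ∀ {j} → EvenStage j (2 + 2 * j) → OddStage j (3 + 2 * j)
even⇒odd {j} even = record
  { value      = odd-next j value
  ; P≡value    = P-odd-values j P≡value recurrence
  ; recurrence = evenRec⇒oddRec j recurrence
  ; value-zero = trans (cong (λ l → (2 * j + 3) * value 1 + l) (lprod-zero (suc j))) (even-at-zero j recurrence value-zero)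
  }
  where open EvenStage even

odd⇒even : ∀ {j} → OddStage j (3 + 2 * j) → EvenStage (suc j) (4 + 2 * j)
odd⇒even {j} odd = record
  { value      = half
  ; P≡value    = P-even-values j {e = half} P≡value recurrence halve
  ; recurrence = oddRec⇒evenRec j {e = half} recurrence halve
  ; value-zero = *-cancelˡ-≡ _ _ 2 (begin
      2 * half 0                   ≡⟨ halve 0 ⟩
      value 1 + lprod (suc j) 0    ≡⟨ cong (λ l → value 1 + l) (lprod-zero (suc j)) ⟩
      value 1 + suc j !            ≡⟨ odd-at-one j recurrence ⟩
      2 * value 0                  ≡⟨ cong (2 *_) value-zero ⟩
      2 * (4 ^ suc j * suc j !)    ∎)
  }
  where
  open OddStage odd
  open ≡-Reasoning
  half : ℕ → ℕ
  half k = quotient (oddRec⇒evenness j recurrence k)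
  halve : ∀ k → 2 * half k ≡ value (suc k) + lprod (suc j) k
  halve k = sym (m∣n⇒n≡m*quotient (oddRec⇒evenness j recurrence k))

even-stage : ∀ j → EvenStage j (2 + 2 * j)
even-stage zero = record
  { value = λ _ → 1 ; P≡value = λ _ → refl ; recurrence = λ k → solve (k ∷ []) ; value-zero = refl }
even-stage (suc j) = subst (EvenStage (suc j)) (cong (λ n → 2 + n) (sym (*-suc 2 j))) (odd⇒even (even⇒odd (even-stage j)))

odd-stage : ∀ j → OddStage j (3 + 2 * j)
odd-stage j = even⇒odd (even-stage j)

P-even-value : ∀ m → P (2 * suc m) 1 ≡ (+ ((2 ^ (2 * suc m) ∸ 1) * (suc m) !)) / (2 * suc m + 1)
P-even-value m = begin
  P (2 * suc m) 1                                       ≡⟨ cong (λ n → P n 1) (*-suc 2 m) ⟩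
  P (2 + 2 * m) 1                                       ≡⟨ P≡value 1 ⟩
  ⟦ value 1 ⟧                                           ≡⟨ [n*x]/n≡⟦x⟧ (2 * suc m + 1) (value 1) ⟨
  (+ ((2 * suc m + 1) * value 1)) / (2 * suc m + 1)     ≡⟨ cong (λ c → (+ c) / (2 * suc m + 1)) numerator ⟩
  (+ ((2 ^ (2 * suc m) ∸ 1) * suc m !)) / (2 * suc m + 1) ∎
  where
  open ≡-Reasoning
  open EvenStage (even-stage m)
  2[1+m]+1≡2m+3 : ∀ m → 2 * suc m + 1 ≡ 2 * m + 3
  2[1+m]+1≡2m+3 = solve-∀
  numerator : (2 * suc m + 1) * value 1 ≡ (2 ^ (2 * suc m) ∸ 1) * suc m !
  numerator = +-cancelʳ-≡ (suc m !) _ _ (begin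
    (2 * suc m + 1) * value 1 + suc m !          ≡⟨ cong (λ d → d * value 1 + suc m !) (2[1+m]+1≡2m+3 m) ⟩
    (2 * m + 3) * value 1 + suc m !              ≡⟨ even-at-zero m recurrence value-zero ⟩
    4 ^ suc m * suc m !                          ≡⟨ cong (_* suc m !) (4^n≡2^[2*n] (suc m)) ⟩
    2 ^ (2 * suc m) * suc m !                    ≡⟨ [m∸1]*n+n≡m*n (2 ^ (2 * suc m)) (suc m !) {{m^n≢0 2 (2 * suc m)}} ⟨
    (2 ^ (2 * suc m) ∸ 1) * suc m ! + suc m !    ∎)

P-odd-value : ∀ m → P (2 * m + 1) 1 ≡ (+ ((2 ^ (2 * m + 1) ∸ 1) * m !)) / 1
P-odd-value zero = refl
P-odd-value (suc j) = begin
  P (2 * suc j + 1) 1     ≡⟨ cong (λ n → P n 1) (trans (+-comm (2 * suc j) 1) (cong suc (*-suc 2 j))) ⟩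
  P (3 + 2 * j) 1         ≡⟨ P≡value 1 ⟩
  ⟦ value 1 ⟧             ≡⟨ cong ⟦_⟧ numerator ⟩
  ⟦ (2 ^ (2 * suc j + 1) ∸ 1) * suc j ! ⟧ ∎
  where
  open ≡-Reasoning
  open OddStage (odd-stage j)
  numerator : value 1 ≡ (2 ^ (2 * suc j + 1) ∸ 1) * suc j !
  numerator = +-cancelʳ-≡ (suc j !) _ _ (begin
    value 1 + suc j !                                ≡⟨ odd-at-one j recurrence ⟩
    2 * value 0                                      ≡⟨ cong (2 *_) value-zero ⟩
    2 * (4 ^ suc j * suc j !)                        ≡⟨ *-assoc 2 (4 ^ suc j) (suc j !) ⟨
    2 * 4 ^ suc j * suc j !                          ≡⟨ cong (λ p → 2 * p * suc j !) (4^n≡2^[2*n] (suc j)) ⟩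
    2 ^ suc (2 * suc j) * suc j !                    ≡⟨ cong (λ e → 2 ^ e * suc j !) (+-comm 1 (2 * suc j)) ⟩
    2 ^ (2 * suc j + 1) * suc j !                    ≡⟨ [m∸1]*n+n≡m*n (2 ^ (2 * suc j + 1)) (suc j !) {{m^n≢0 2 (2 * suc j + 1)}} ⟨
    (2 ^ (2 * suc j + 1) ∸ 1) * suc j ! + suc j !    ∎)

mainTheorem4 : (m : ℕ)
    → (P (2 * suc m) 1 ≡ (+ ((2 ^ (2 * suc m) ∸ 1) * (suc m) !)) / (2 * suc m + 1))
      × (P (2 * m + 1) 1 ≡ (+ ((2 ^ (2 * m + 1) ∸ 1) * m !)) / 1)
mainTheorem4 m = P-even-value m , P-odd-value m
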